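{- For every integer $f \ge 2$, the pair $(2, f-2)$ is not restorable relative to $f$; that is, there exist an undirected unweighted graph $G$ and an $f$-fault replacement path in $G$ that cannot be partitioned into $2$ consecutive subpaths which are each $(f-2)$-fault replacement paths in $G$.
   Context: All graphs are finite, undirected and unweighted. For an integer $r$, a path $\pi$ in a graph $G=(V,E)$ is an $r$-fault replacement path if there exists a set of edges $F \subseteq E$ with $|F| \le r$ such that $\pi$ is a shortest path between its endpoints in $G \setminus F$. Relative to a value of $f$, a pair $(q, r)$ is called restorable if in every graph $G$, every $f$-fault replacement path can be partitioned into $q$ consecutive subpaths (consecutive subpaths sharing their boundary vertex) which are each $r$-fault replacement paths in $G$. -}

module Defs where

open import Data.Nat using (ℕ; zero; suc; _≤_)
open import Data.Fin using (Fin)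
open import Data.Bool using (Bool; true; false)
open import Data.List using (List; []; _∷_; _++_; _∷ʳ_; length; head; last)
open import Data.List.Relation.Unary.All using (All)
open import Data.List.Relation.Unary.Linked using (Linked)
open import Data.List.Membership.Propositional using (_∈_)
open import Data.Product using (Σ; _×_; _,_; ∃-syntax)
open import Data.Sum using (_⊎_)
open import Data.Empty using (⊥)
open import Relation.Nullary using (¬_)
open import Relation.Binary.PropositionalEquality using (_≡_; _≢_)

record Graph : Set where
  field
    n      : ℕ
    adj    : Fin n → Fin n → Bool
    sym    : ∀ u v → adj u v ≡ adj v u
    irrefl : ∀ u → adj u u ≡ false

module _ (G : Graph) where
  open Graph G

  Vertex : Set
  Vertex = Fin n

  -- an (unordered) edge {u,v} is represented by either ordered pair (u , v) or (v , u)
  IsEdge : Vertex × Vertex → Set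
  IsEdge (u , v) = adj u v ≡ true

  AdjMinus : List (Vertex × Vertex) → Vertex → Vertex → Set
  AdjMinus F u v = (adj u v ≡ true) × ¬ (((u , v) ∈ F) ⊎ ((v , u) ∈ F))

  -- a path is a nonempty list of vertices, consecutive ones adjacent;
  -- its length is (number of vertices - 1), so comparing vertex counts compares lengths.
  -- π is a shortest path between its endpoints in the graph with adjacency R
  IsShortestPath : (Vertex → Vertex → Set) → List Vertex → Set
  IsShortestPath R π =
    (π ≢ []) × Linked R π ×
    (∀ (ρ : List Vertex) → Linked R ρ → head ρ ≡ head π → last ρ ≡ last π →
       length π ≤ length ρ)

  -- r-fault replacement path: shortest path in G \ F for some edge set F ⊆ E, |F| ≤ r
  -- (F given as a list; duplicates only overcount |F|, so this is faithful)
  ReplacementPath : ℕ → List Vertex → Set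
  ReplacementPath r π =
    Σ (List (Vertex × Vertex)) λ F →
      All IsEdge F × length F ≤ r × IsShortestPath (AdjMinus F) π

Partition : {A : Set} → (List A → Set) → ℕ → List A → Set
Partition P zero π = ⊥
Partition P (suc zero) π = P π
Partition P (suc (suc q)) π =
  ∃[ xs ] ∃[ m ] ∃[ ys ]
    (π ≡ xs ++ (m ∷ ys)) × P (xs ∷ʳ m) × Partition P (suc q) (m ∷ ys)

Restorable : ℕ → ℕ → ℕ → Set
Restorable f q r =
  ∀ (G : Graph) (π : List (Vertex G)) →
    ReplacementPath G f π → Partition (ReplacementPath G r) q π

-- The graph has layers 0 … L, each consisting of W = 2g + 2 lanes, and any two vertices in
-- consecutive layers are adjacent. The path π runs along lane 0 through all layers, and lane 0
-- also carries g + 2 chords 0–L, M–L and 0–x u (u < g), where M = 3g + 3, L = 2M + 2 and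
-- x u = M + 3u. Once all chords are deleted every edge changes the layer by at most one, so π is
-- a shortest path: a (g + 2)-fault replacement path.
--
-- Split π at layer k and suppose both parts are g-fault replacement paths. A fault coincides
-- with at most one chord and touches at most two lanes, so the g faults of a part leave two
-- chords and one spare lane intact. If k ≥ M the prefix is beaten by 0 → L → M ⇝ k, or by
-- 0 → x u ⇝ k, descending through the intact lane when x u > k. If k < M the suffix is beaten
-- by k ⇝ M → L, by k ⇝ x u → 0 → L, or by k ⇝ x u → 0 → x u′ ⇝ L, the points x u being three
-- layers apart.

module Submission where

open import Defs
open import Data.Bool using (true)
open import Data.Empty using (⊥; ⊥-elim)
open import Data.Fin using (Fin; toℕ; combine; remQuot)
open import Data.Fin.Properties using (remQuot-combine; combine-remQuot; toℕ-fromℕ<; toℕ-injective; toℕ<n)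
  renaming (_≟_ to _≟ᶠ_)
open import Data.List using (List; []; _∷_; _++_; _∷ʳ_; length; head; last)
open import Data.List.Membership.Propositional using (_∈_)
open import Data.List.Properties using (∷-injectiveˡ; ∷-injectiveʳ)
open import Data.List.Relation.Unary.All using (All; []; _∷_)
open import Data.List.Relation.Unary.Any using (Any; here; there; any?)
import Data.List.Relation.Unary.Any as Any
open import Data.List.Relation.Unary.Linked using (Linked; []; [-]; _∷_)
import Data.List.Relation.Unary.Linked as Linked
open import Data.Maybe using (just)
open import Data.Maybe.Properties using (just-injective)
open import Data.Nat using (ℕ; zero; suc; _+_; _*_; _∸_; _≤_; _<_; z≤n; s≤s; s≤s⁻¹; z<s; ∣_-_∣; _≟_; _≤?_)
open import Data.Nat.DivMod using (_mod_; _%_; m<n⇒m%n≡m)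
open import Data.Nat.Properties
open import Data.Product using (Σ; ∃; ∃₂; _×_; _,_; proj₁; proj₂)
import Data.Product as Product
open import Data.Product.Properties using (≡-dec)
open import Data.Sum using (_⊎_; inj₁; inj₂)
import Data.Sum as Sum
open import Function using (_∘_; mk⇔)
open import Relation.Binary.Definitions using (tri<; tri≈; tri>)
open import Relation.Binary.PropositionalEquality
open import Relation.Nullary using (¬_; Dec; yes; no; does)
open import Relation.Nullary.Decidable using (_⊎-dec_; _×-dec_; does-⇔; dec-true; dec-false)

private
  variable
    A : Set

m<n⇒m+[o∸n]<o : ∀ {m n o} → m < n → n ≤ o → m + (o ∸ n) < o
m<n⇒m+[o∸n]<o {m} {n} {o} m<n n≤o = subst (m + (o ∸ n) <_) (m+[n∸m]≡n n≤o) (+-monoˡ-< (o ∸ n) m<n)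

[m∸n]+o<p : ∀ {m n o p} → n ≤ m → m + o < n + p → (m ∸ n) + o < p
[m∸n]+o<p {m} {n} {o} {p} n≤m lt = +-cancelˡ-< n _ p
  (subst (_< n + p) (trans (cong (_+ o) (sym (m+[n∸m]≡n n≤m))) (+-assoc n (m ∸ n) o)) lt)

[m∸n]+o≤n : ∀ {m n o} → n ≤ m → m + o ≤ n + n → (m ∸ n) + o ≤ n
[m∸n]+o≤n {m} {n} {o} n≤m le = +-cancelˡ-≤ n _ n
  (subst (_≤ n + n) (trans (cong (_+ o) (sym (m+[n∸m]≡n n≤m))) (+-assoc n (m ∸ n) o)) le)

dec-true⁻¹ : ∀ {P : Set} (P? : Dec P) → does P? ≡ true → P
dec-true⁻¹ (yes p) _ = p

∣n-1+n∣≤1 : ∀ n → ∣ n - suc n ∣ ≤ 1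
∣n-1+n∣≤1 zero = ≤-refl
∣n-1+n∣≤1 (suc n) = ∣n-1+n∣≤1 n

-- Walks

module _ {A : Set} (R : A → A → Set) where

  infixr 5 _◅_

  data Walk : A → A → ℕ → Set where
    ε   : ∀ {a} → Walk a a 0
    _◅_ : ∀ {a b c n} → R a b → Walk b c n → Walk a c (suc n)

module _ {A : Set} {R : A → A → Set} where

  private
    variable
      a b c : A
      m n : ℕ

  infixr 5 _◅◅_

  _◅◅_ : Walk R a b m → Walk R b c n → Walk R a c (m + n)
  ε ◅◅ w′ = w′
  (r ◅ w) ◅◅ w′ = r ◅ (w ◅◅ w′)

  reverse : (∀ {x y} → R x y → R y x) → Walk R a b n → Walk R b a n
  reverse sym ε = ε
  reverse sym (_◅_ {n = n} r w) = subst (Walk R _ _) (+-comm n 1) (reverse sym w ◅◅ (sym r ◅ ε))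

  vertices : Walk R a b n → List A
  vertices {a = a} ε = a ∷ []
  vertices {a = a} (r ◅ w) = a ∷ vertices w

  vertices-linked : (w : Walk R a b n) → Linked R (vertices w)
  vertices-linked ε = [-]
  vertices-linked (r ◅ ε) = r ∷ [-]
  vertices-linked (r ◅ w@(_ ◅ _)) = r ∷ vertices-linked w

  last-vertices : (w : Walk R a b n) → last (vertices w) ≡ just b
  last-vertices ε = refl
  last-vertices (r ◅ ε) = refl
  last-vertices (r ◅ w@(_ ◅ _)) = last-vertices w

  length-vertices : (w : Walk R a b n) → length (vertices w) ≡ suc n
  length-vertices ε = refl
  length-vertices (r ◅ w) = cong suc (length-vertices w)

  linked⇒walk : ∀ {ρ} → Linked R ρ → head ρ ≡ just a → last ρ ≡ just b →
                Walk R a b (length ρ ∸ 1)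
  linked⇒walk [-] refl refl = ε
  linked⇒walk (r ∷ l) refl eq = r ◅ linked⇒walk l refl eq

  shortest≤walk : ∀ {π} →
    (∀ ρ → Linked R ρ → head ρ ≡ head π → last ρ ≡ last π → length π ≤ length ρ) →
    head π ≡ just a → last π ≡ just b → Walk R a b n → length π ≤ suc n
  shortest≤walk {π = π} shortest h l w = subst (length π ≤_) (length-vertices w)
    (shortest (vertices w) (vertices-linked w) (trans (head-vertices w) (sym h)) (trans (last-vertices w) (sym l)))
    where
    head-vertices : (w : Walk R a b n) → head (vertices w) ≡ just a
    head-vertices ε = refl
    head-vertices (_ ◅ _) = refl

  walk-potential : (h : A → ℕ) → (∀ {x y} → R x y → ∣ h x - h y ∣ ≤ 1) →
                   Walk R a b n → ∣ h a - h b ∣ ≤ n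
  walk-potential h step ε = ≤-reflexive (∣n-n∣≡0 (h _))
  walk-potential {a = a} {b = b} h step (_◅_ {b = y} r w) = begin
    ∣ h a - h b ∣                 ≤⟨ ∣-∣-triangle (h a) (h y) (h b) ⟩
    ∣ h a - h y ∣ + ∣ h y - h b ∣ ≤⟨ +-mono-≤ (step r) (walk-potential h step w) ⟩
    suc _                         ∎
    where open ≤-Reasoning

run : (ℕ → A) → ℕ → List A
run v zero = v 0 ∷ []
run v (suc n) = v 0 ∷ run (v ∘ suc) n

head-run : ∀ (v : ℕ → A) n → head (run v n) ≡ just (v 0)
head-run v zero = refl
head-run v (suc n) = refl

last-run : ∀ (v : ℕ → A) n → last (run v n) ≡ just (v n)
last-run v zero = refl
last-run v (suc zero) = refl
last-run v (suc (suc n)) = last-run (v ∘ suc) (suc n)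

length-run : ∀ (v : ℕ → A) n → length (run v n) ≡ suc n
length-run v zero = refl
length-run v (suc n) = cong suc (length-run (v ∘ suc) n)

run-split : ∀ (v : ℕ → A) n xs m ys → run v n ≡ xs ++ m ∷ ys →
  ∃₂ λ k l → k + l ≡ n × xs ∷ʳ m ≡ run v k × m ∷ ys ≡ run (v ∘ (k +_)) l
run-split v n [] m ys eq =
  0 , n , refl , cong (_∷ []) (just-injective (trans (cong head (sym eq)) (head-run v n))) , sym eq
run-split v zero (x ∷ []) m ys ()
run-split v zero (x ∷ _ ∷ _) m ys ()
run-split v (suc n) (x ∷ xs) m ys eq with run-split (v ∘ suc) n xs m ys (∷-injectiveʳ eq)
... | k , l , k+l≡n , prefix , suffix =
  suc k , l , cong suc k+l≡n , cong₂ _∷_ (sym (∷-injectiveˡ eq)) prefix , suffix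

module _ {A : Set} {R : A → A → Set} where

  Steps : (ℕ → A) → ℕ → ℕ → Set
  Steps v i j = ∀ {l} → i ≤ l → l < j → R (v l) (v (suc l))

  steps⇒linked-run : ∀ v n → Steps v 0 n → Linked R (run v n)
  steps⇒linked-run v zero steps = [-]
  steps⇒linked-run v (suc zero) steps = steps z≤n (s≤s z≤n) ∷ [-]
  steps⇒linked-run v (suc (suc n)) steps =
    steps z≤n (s≤s z≤n) ∷ steps⇒linked-run (v ∘ suc) (suc n) λ _ l<n → steps z≤n (s≤s l<n)

  linked-run⇒steps : ∀ v k m → Linked R (run (v ∘ (k +_)) m) → Steps v k (k + m)
  linked-run⇒steps v zero (suc zero) (r ∷ [-]) {zero} _ _ = r
  linked-run⇒steps v zero (suc (suc m)) (r ∷ _) {zero} _ _ = r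
  linked-run⇒steps v zero (suc m) linked {suc l} _ (s≤s l<m) =
    linked-run⇒steps (v ∘ suc) zero m (Linked.tail linked) z≤n l<m
  linked-run⇒steps v (suc k) m linked (s≤s k≤l) (s≤s l<k+m) =
    linked-run⇒steps (v ∘ suc) k m linked k≤l l<k+m

  steps-within : ∀ {v i j i′ j′} → Steps v i j → i ≤ i′ → j′ ≤ j → Steps v i′ j′
  steps-within steps i≤i′ j′≤j i′≤l l<j′ = steps (≤-trans i≤i′ i′≤l) (<-≤-trans l<j′ j′≤j)

  walk-between : ∀ v {i j} → Steps v i j → i ≤ j → Walk R (v i) (v j) (j ∸ i)
  walk-between v {j = zero} steps z≤n = ε
  walk-between v {j = suc j} steps z≤n =
    steps z≤n (s≤s z≤n) ◅ walk-between (v ∘ suc) (λ _ l<j → steps z≤n (s≤s l<j)) z≤n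
  walk-between v steps (s≤s i≤j) =
    walk-between (v ∘ suc) (λ i≤l l<j → steps (s≤s i≤l) (s≤s l<j)) i≤j

-- Counting indices below a bound

module _ {P : ℕ → Set} where

  count : (∀ i → Dec (P i)) → ℕ → ℕ
  count P? zero = 0
  count P? (suc n) with P? n
  ... | yes _ = suc (count P? n)
  ... | no _ = count P? n

  count≡0 : ∀ P? n → (∀ {i} → i < n → ¬ P i) → count P? n ≡ 0
  count≡0 P? zero none = refl
  count≡0 P? (suc n) none with P? n
  ... | yes p = ⊥-elim (none ≤-refl p)
  ... | no _ = count≡0 P? n (none ∘ m≤n⇒m≤1+n)

  count≤1 : ∀ P? n → (∀ {i j} → i < n → j < n → P i → P j → i ≡ j) → count P? n ≤ 1
  count≤1 P? zero unique = z≤n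
  count≤1 P? (suc n) unique with P? n
  ... | yes p = s≤s (≤-reflexive (count≡0 P? n λ i<n q →
                  <-irrefl (unique (m≤n⇒m≤1+n i<n) ≤-refl q p) i<n))
  ... | no _ = count≤1 P? n λ i<n j<n → unique (m≤n⇒m≤1+n i<n) (m≤n⇒m≤1+n j<n)

  count<⇒∃¬ : ∀ P? n → count P? n < n → ∃ λ i → i < n × ¬ P i
  count<⇒∃¬ P? (suc n) lt with P? n
  ... | no ¬p = n , ≤-refl , ¬p
  ... | yes _ with count<⇒∃¬ P? n (s≤s⁻¹ lt)
  ...   | i , i<n , ¬p = i , m≤n⇒m≤1+n i<n , ¬p

module _ {P Q : ℕ → Set} where

  count-mono : ∀ P? Q? n → (∀ {i} → P i → Q i) → count {P} P? n ≤ count {Q} Q? n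
  count-mono P? Q? zero P⇒Q = z≤n
  count-mono P? Q? (suc n) P⇒Q with P? n | Q? n
  ... | yes _ | yes _ = s≤s (count-mono P? Q? n P⇒Q)
  ... | yes p | no ¬q = ⊥-elim (¬q (P⇒Q p))
  ... | no _ | yes _ = m≤n⇒m≤1+n (count-mono P? Q? n P⇒Q)
  ... | no _ | no _ = count-mono P? Q? n P⇒Q

  count-⊎ : ∀ P? Q? n → count (λ i → P? i ⊎-dec Q? i) n ≤ count {P} P? n + count {Q} Q? n
  count-⊎ P? Q? zero = z≤n
  count-⊎ P? Q? (suc n) with P? n | Q? n
  ... | yes _ | yes _ = s≤s (≤-trans (count-⊎ P? Q? n) (+-monoʳ-≤ (count P? n) (n≤1+n _)))
  ... | yes _ | no _ = s≤s (count-⊎ P? Q? n)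
  ... | no _ | yes _ = ≤-trans (s≤s (count-⊎ P? Q? n)) (≤-reflexive (sym (+-suc _ _)))
  ... | no _ | no _ = count-⊎ P? Q? n

count+2≤⇒∃₂¬ : ∀ {P : ℕ → Set} (P? : ∀ i → Dec (P i)) n → count P? n + 2 ≤ n →
  ∃₂ λ i j → i < j × j < n × ¬ P i × ¬ P j
count+2≤⇒∃₂¬ P? n bound with count<⇒∃¬ P? n (<-≤-trans (m<m+n (count P? n) (s≤s z≤n)) bound)
... | i , i<n , ¬pi with count<⇒∃¬ (λ j → P? j ⊎-dec j ≟ i) n (begin-strict
        count (λ j → P? j ⊎-dec j ≟ i) n    ≤⟨ count-⊎ P? (_≟ i) n ⟩
        count P? n + count (_≟ i) n
          ≤⟨ +-monoʳ-≤ (count P? n) (count≤1 (_≟ i) n λ _ _ j≡i k≡i → trans j≡i (sym k≡i)) ⟩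
        count P? n + 1                      <⟨ +-monoʳ-< (count P? n) ≤-refl ⟩
        count P? n + 2                      ≤⟨ bound ⟩
        n                                   ∎)
  where open ≤-Reasoning
... | j , j<n , ¬pj⊎j≡i with <-cmp i j
...   | tri< i<j _ _ = i , j , i<j , j<n , ¬pi , ¬pj⊎j≡i ∘ inj₁
...   | tri≈ _ i≡j _ = ⊥-elim (¬pj⊎j≡i (inj₂ (sym i≡j)))
...   | tri> _ _ j<i = j , i , j<i , i<n , ¬pj⊎j≡i ∘ inj₁ , ¬pi

count-any : ∀ {E : Set} {B : E → ℕ → Set} (B? : ∀ e i → Dec (B e i)) n b →
  (∀ e → count (B? e) n ≤ b) → ∀ F →
  count (λ i → any? (λ e → B? e i) F) n ≤ length F * b
count-any B? n b bound [] = ≤-reflexive (count≡0 _ n λ _ ())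
count-any B? n b bound (e ∷ F) = begin
  count (λ i → any? (λ e → B? e i) (e ∷ F)) n
    ≤⟨ count-mono _ (λ i → B? e i ⊎-dec any? (λ e → B? e i) F) n Any.toSum ⟩
  count (λ i → B? e i ⊎-dec any? (λ e → B? e i) F) n
    ≤⟨ count-⊎ (B? e) _ n ⟩
  count (B? e) n + count (λ i → any? (λ e → B? e i) F) n
    ≤⟨ +-mono-≤ (bound e) (count-any B? n b bound F) ⟩
  b + length F * b ∎
  where open ≤-Reasoning

-- The construction

module Construction (g : ℕ) where

  M L W : ℕ
  M = 3 + 3 * g
  L = 2 + (M + M)
  W = 2 + 2 * g

  x : ℕ → ℕ
  x u = M + 3 * u

  chordLo chordHi : ℕ → ℕ
  chordLo 0 = 0
  chordLo 1 = M
  chordLo (suc (suc u)) = 0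
  chordHi 0 = L
  chordHi 1 = L
  chordHi (suc (suc u)) = x u

  x-suc : ∀ u → x u + 3 ≡ x (suc u)
  x-suc u = trans (+-assoc M (3 * u) 3) (cong (M +_) (trans (+-comm (3 * u) 3) (sym (*-suc 3 u))))

  x-mono : ∀ {u u′} → u ≤ u′ → x u ≤ x u′
  x-mono u≤u′ = +-monoʳ-≤ M (*-monoʳ-≤ 3 u≤u′)

  x-gap : ∀ {u u′} → u < u′ → x u + 3 ≤ x u′
  x-gap {u} {u′} u<u′ = subst (_≤ x u′) (sym (x-suc u)) (x-mono u<u′)

  x+3≤L : ∀ {u} → u < g → x u + 3 ≤ L
  x+3≤L u<g = ≤-trans (x-gap u<g) (≤-trans (+-monoʳ-≤ M (m≤n+m (3 * g) 3)) (m≤n+m (M + M) 2))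

  x<L : ∀ {u} → u < g → x u < L
  x<L {u} u<g = <-≤-trans (m<m+n (x u) {3} z<s) (x+3≤L u<g)

  L<M+L : L < M + L
  L<M+L = m<n+m L {M} z<s

  x≤L : ∀ {u} → u < g → x u ≤ L
  x≤L u<g = <⇒≤ (x<L u<g)

  x+2≤k+k : ∀ {u k} → u < g → M ≤ suc k → x u + 2 ≤ k + k
  x+2≤k+k {u} {k} u<g M≤1+k = begin
    x u + 2                     ≤⟨ +-monoʳ-≤ (x u) (n≤1+n 2) ⟩
    x u + 3                     ≤⟨ x-gap u<g ⟩
    x g                         ≤⟨ +-monoʳ-< (2 + 3 * g) (m<n+m (3 * g) {2} z<s) ⟩
    (2 + 3 * g) + (2 + 3 * g)   ≤⟨ +-mono-≤ (s≤s⁻¹ M≤1+k) (s≤s⁻¹ M≤1+k) ⟩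
    k + k                       ∎
    where open ≤-Reasoning

  M≤L : M ≤ L
  M≤L = ≤-trans (m≤m+n M M) (m≤n+m (M + M) 2)

  M+1<L : M + 1 < L
  M+1<L = s≤s (≤-trans (+-monoʳ-≤ M (s≤s z≤n)) (n≤1+n (M + M)))

  IsChord : ℕ → ℕ → Set
  IsChord i j = ∃ λ t → t < 2 + g × chordLo t ≡ i × chordHi t ≡ j

  isChord? : ∀ i j → Dec (IsChord i j)
  isChord? i j = anyUpTo? (λ t → (chordLo t ≟ i) ×-dec (chordHi t ≟ j)) (2 + g)

  Near : ℕ → ℕ → ℕ → ℕ → Set
  Near i c j d = (suc i ≡ j ⊎ suc j ≡ i) ⊎ (c ≡ 0 × d ≡ 0 × (IsChord i j ⊎ IsChord j i))

  near? : ∀ i c j d → Dec (Near i c j d)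
  near? i c j d = ((suc i ≟ j) ⊎-dec (suc j ≟ i))
           ⊎-dec ((c ≟ 0) ×-dec (d ≟ 0) ×-dec (isChord? i j ⊎-dec isChord? j i))

  near-sym : ∀ {i c j d} → Near i c j d → Near j d i c
  near-sym (inj₁ consecutive) = inj₁ (Sum.swap consecutive)
  near-sym (inj₂ (c≡0 , d≡0 , chord)) = inj₂ (d≡0 , c≡0 , Sum.swap chord)

  chordLo+2≤chordHi : ∀ t → 2 + chordLo t ≤ chordHi t
  chordLo+2≤chordHi 0 = s≤s (s≤s z≤n)
  chordLo+2≤chordHi 1 = s≤s (s≤s (m≤m+n M M))
  chordLo+2≤chordHi (suc (suc u)) = s≤s (s≤s z≤n)

  chord-irrefl : ∀ {i} → ¬ IsChord i i
  chord-irrefl (t , _ , refl , hi) = 1+n≰n (≤-trans (n≤1+n _) (subst (2 + chordLo t ≤_) hi (chordLo+2≤chordHi t)))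

  near-irrefl : ∀ {i c} → ¬ Near i c i c
  near-irrefl (inj₁ (inj₁ eq)) = 1+n≢n eq
  near-irrefl (inj₁ (inj₂ eq)) = 1+n≢n eq
  near-irrefl (inj₂ (_ , _ , inj₁ chord)) = chord-irrefl chord
  near-irrefl (inj₂ (_ , _ , inj₂ chord)) = chord-irrefl chord

  V : Set
  V = Fin (suc L * W)

  -- Vertices are pairs (layer, lane) ∈ [0, L] × [0, W); out of range arguments wrap around.
  opaque
    vertex : ℕ → ℕ → V
    vertex a c = combine (a mod suc L) (c mod W)

    layer lane : V → ℕ
    layer u = toℕ (proj₁ (remQuot {suc L} W u))
    lane u = toℕ (proj₂ (remQuot {suc L} W u))

    layer-vertex : ∀ {a} c → a ≤ L → layer (vertex a c) ≡ a
    layer-vertex {a} c a≤L = begin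
      toℕ (proj₁ (remQuot {suc L} W (combine (a mod suc L) (c mod W))))
        ≡⟨ cong (toℕ ∘ proj₁) (remQuot-combine {suc L} {W} (a mod suc L) (c mod W)) ⟩
      toℕ (a mod suc L)                                          ≡⟨ toℕ-fromℕ< _ ⟩
      a % suc L                                                  ≡⟨ m<n⇒m%n≡m (s≤s a≤L) ⟩
      a                                                          ∎
      where open ≡-Reasoning

    lane-vertex : ∀ a {c} → c < W → lane (vertex a c) ≡ c
    lane-vertex a {c} c<W = begin
      toℕ (proj₂ (remQuot {suc L} W (combine (a mod suc L) (c mod W))))
        ≡⟨ cong (toℕ ∘ proj₂) (remQuot-combine {suc L} {W} (a mod suc L) (c mod W)) ⟩
      toℕ (c mod W)                                              ≡⟨ toℕ-fromℕ< _ ⟩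
      c % W                                                      ≡⟨ m<n⇒m%n≡m c<W ⟩
      c                                                          ∎
      where open ≡-Reasoning

    vertex-layer-lane : ∀ u → vertex (layer u) (lane u) ≡ u
    vertex-layer-lane u =
      trans (cong₂ combine (mod-toℕ (proj₁ (remQuot {suc L} W u))) (mod-toℕ (proj₂ (remQuot {suc L} W u))))
            (combine-remQuot {suc L} W u)
      where
      mod-toℕ : ∀ {n} (i : Fin (suc n)) → toℕ i mod suc n ≡ i
      mod-toℕ i = toℕ-injective (trans (toℕ-fromℕ< _) (m<n⇒m%n≡m (toℕ<n i)))

  Nearᵥ : V → V → Set
  Nearᵥ u v = Near (layer u) (lane u) (layer v) (lane v)

  near?ᵥ : ∀ u v → Dec (Nearᵥ u v)
  near?ᵥ u v = near? (layer u) (lane u) (layer v) (lane v)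

  G : Graph
  G = record
    { n      = suc L * W
    ; adj    = λ u v → does (near?ᵥ u v)
    ; sym    = λ u v → does-⇔ (mk⇔ near-sym near-sym) (near?ᵥ u v) (near?ᵥ v u)
    ; irrefl = λ u → dec-false (near?ᵥ u u) near-irrefl
    }

  near⇒edge : ∀ {a c b d} → a ≤ L → b ≤ L → c < W → d < W → Near a c b d →
              Graph.adj G (vertex a c) (vertex b d) ≡ true
  near⇒edge {a} {c} {b} {d} a≤L b≤L c<W d<W near
    rewrite layer-vertex c a≤L | layer-vertex d b≤L | lane-vertex a c<W | lane-vertex b d<W =
    dec-true (near? a c b d) near

  edge⇒near : ∀ {u v} → Graph.adj G u v ≡ true → Nearᵥ u v
  edge⇒near {u} {v} = dec-true⁻¹ (near?ᵥ u v)

  Faults : Set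
  Faults = List (V × V)

  Adj∖ : Faults → V → V → Set
  Adj∖ = AdjMinus G

  Adj∖-sym : ∀ {F u v} → Adj∖ F u v → Adj∖ F v u
  Adj∖-sym {u = u} {v} (adj , ∉F) = trans (Graph.sym G v u) adj , ∉F ∘ Sum.swap

  p : ℕ → V
  p i = vertex i 0

  0<W : 0 < W
  0<W = s≤s z≤n

  lane≡0⇒p-layer : ∀ {u} → lane u ≡ 0 → p (layer u) ≡ u
  lane≡0⇒p-layer {u} lane≡0 = trans (cong (vertex (layer u)) (sym lane≡0)) (vertex-layer-lane u)

  chordHi≤L : ∀ {t} → t < 2 + g → chordHi t ≤ L
  chordHi≤L {0} _ = ≤-refl
  chordHi≤L {1} _ = ≤-refl
  chordHi≤L {suc (suc u)} (s≤s (s≤s u<g)) = x≤L u<g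

  chordLo≤L : ∀ {t} → t < 2 + g → chordLo t ≤ L
  chordLo≤L {t} t< = ≤-trans (m≤n+m (chordLo t) 2) (≤-trans (chordLo+2≤chordHi t) (chordHi≤L t<))

  chordEdge : ℕ → V × V
  chordEdge t = (p (chordLo t) , p (chordHi t))

  chords : ℕ → Faults
  chords zero = []
  chords (suc n) = chordEdge n ∷ chords n

  length-chords : ∀ n → length (chords n) ≡ n
  length-chords zero = refl
  length-chords (suc n) = cong suc (length-chords n)

  chordEdge∈chords : ∀ {t n} → t < n → chordEdge t ∈ chords n
  chordEdge∈chords {n = suc n} t<1+n with m≤n⇒m<n∨m≡n (s≤s⁻¹ t<1+n)
  ... | inj₁ t<n = there (chordEdge∈chords t<n)
  ... | inj₂ refl = here refl

  ∈chords⇒chordEdge : ∀ {e n} → e ∈ chords n → ∃ λ t → t < n × e ≡ chordEdge t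
  ∈chords⇒chordEdge {n = suc n} (here refl) = n , ≤-refl , refl
  ∈chords⇒chordEdge {n = suc n} (there e∈) with ∈chords⇒chordEdge e∈
  ... | t , t<n , refl = t , m≤n⇒m≤1+n t<n , refl

  chord-near : ∀ {t} → t < 2 + g → Near (chordLo t) 0 (chordHi t) 0
  chord-near t< = inj₂ (refl , refl , inj₁ (_ , t< , refl , refl))

  chord-edge : ∀ {t} → t < 2 + g → IsEdge G (chordEdge t)
  chord-edge t< = near⇒edge (chordLo≤L t<) (chordHi≤L t<) 0<W 0<W (chord-near t<)

  chords-edges : ∀ {n} → n ≤ 2 + g → All (IsEdge G) (chords n)
  chords-edges {zero} _ = []
  chords-edges {suc n} n<2+g = chord-edge n<2+g ∷ chords-edges (<⇒≤ n<2+g)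

  chord-span : ∀ {u v} → (u , v) ∈ chords (2 + g) → 2 + layer u ≤ layer v
  chord-span e∈ with ∈chords⇒chordEdge e∈
  ... | t , t< , refl rewrite layer-vertex 0 (chordLo≤L t<) | layer-vertex 0 (chordHi≤L t<) =
    chordLo+2≤chordHi t

  chord⇒∈chords : ∀ {u v} → lane u ≡ 0 → lane v ≡ 0 → IsChord (layer u) (layer v) →
                  (u , v) ∈ chords (2 + g)
  chord⇒∈chords lane-u lane-v (t , t< , lo , hi) =
    subst (_∈ chords (2 + g))
          (cong₂ _,_ (trans (cong p lo) (lane≡0⇒p-layer lane-u)) (trans (cong p hi) (lane≡0⇒p-layer lane-v)))
          (chordEdge∈chords t<)

  layer-step : ∀ {u v} → Adj∖ (chords (2 + g)) u v → ∣ layer u - layer v ∣ ≤ 1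
  layer-step {u} {v} (adj , ∉F) with edge⇒near adj
  ... | inj₁ (inj₁ eq) = subst (λ j → ∣ layer u - j ∣ ≤ 1) eq (∣n-1+n∣≤1 (layer u))
  ... | inj₁ (inj₂ eq) =
    subst (λ i → ∣ i - layer v ∣ ≤ 1) eq (subst (_≤ 1) (∣-∣-comm (layer v) _) (∣n-1+n∣≤1 (layer v)))
  ... | inj₂ (lane-u , lane-v , inj₁ chord) = ⊥-elim (∉F (inj₁ (chord⇒∈chords lane-u lane-v chord)))
  ... | inj₂ (lane-u , lane-v , inj₂ chord) = ⊥-elim (∉F (inj₂ (chord⇒∈chords lane-v lane-u chord)))

  π : List V
  π = run p L

  path-edge : ∀ {i} → i < L → Adj∖ (chords (2 + g)) (p i) (p (suc i))
  path-edge {i} i<L = near⇒edge (<⇒≤ i<L) i<L 0<W 0<W (inj₁ (inj₁ refl)) , Sum.[ forward , backward ]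
    where
    forward : ¬ (p i , p (suc i)) ∈ chords (2 + g)
    forward e∈ = 1+n≰n (subst₂ (λ a b → 2 + a ≤ b) (layer-vertex 0 (<⇒≤ i<L)) (layer-vertex 0 i<L)
                                (chord-span e∈))
    backward : ¬ (p (suc i) , p i) ∈ chords (2 + g)
    backward e∈ = m+n≮n 2 i (subst₂ (λ a b → 2 + a ≤ b) (layer-vertex 0 i<L) (layer-vertex 0 (<⇒≤ i<L))
                                    (chord-span e∈))

  π-replacement : ReplacementPath G (2 + g) π
  π-replacement = chords (2 + g) , chords-edges ≤-refl , ≤-reflexive (length-chords (2 + g)) , (λ ()) ,
                  steps⇒linked-run p L (λ _ i<L → path-edge i<L) , shortest
    where
    shortest : ∀ ρ → Linked (Adj∖ (chords (2 + g))) ρ → head ρ ≡ head π → last ρ ≡ last π →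
               length π ≤ length ρ
    shortest (u ∷ ρ) linked refl last≡ = begin
      length π
        ≡⟨ length-run p L ⟩
      suc L
        ≡⟨ cong suc (sym (cong₂ ∣_-_∣ (layer-vertex 0 z≤n) (layer-vertex 0 ≤-refl))) ⟩
      suc ∣ layer (p 0) - layer (p L) ∣
        ≤⟨ s≤s (walk-potential layer layer-step (linked⇒walk linked refl (trans last≡ (last-run p L)))) ⟩
      length (u ∷ ρ) ∎
      where open ≤-Reasoning

  -- Chords and spare lanes that survive g faults

  Hits : V × V → ℕ → Set
  Hits e t = chordEdge t ≡ e ⊎ Product.swap (chordEdge t) ≡ e

  hits? : ∀ e t → Dec (Hits e t)
  hits? e t = ≡-dec _≟ᶠ_ _≟ᶠ_ (chordEdge t) e ⊎-dec ≡-dec _≟ᶠ_ _≟ᶠ_ (Product.swap (chordEdge t)) e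

  ChordBlocked : Faults → ℕ → Set
  ChordBlocked F t = Any (λ e → Hits e t) F

  weight : V × V → ℕ
  weight (u , v) = layer u + layer v

  hits⇒weight : ∀ {e t} → t < 2 + g → Hits e t → weight e ≡ chordLo t + chordHi t
  hits⇒weight t< (inj₁ refl) = cong₂ _+_ (layer-vertex 0 (chordLo≤L t<)) (layer-vertex 0 (chordHi≤L t<))
  hits⇒weight {t = t} t< (inj₂ refl) =
    trans (cong₂ _+_ (layer-vertex 0 (chordHi≤L t<)) (layer-vertex 0 (chordLo≤L t<))) (+-comm (chordHi t) _)

  chord-weight-injective : ∀ {s t} → s < 2 + g → t < 2 + g →
                           chordLo s + chordHi s ≡ chordLo t + chordHi t → s ≡ t
  chord-weight-injective {0} {0} _ _ _ = refl
  chord-weight-injective {0} {1} _ _ eq = ⊥-elim (<-irrefl eq L<M+L)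
  chord-weight-injective {0} {suc (suc u)} _ (s≤s (s≤s u<g)) eq = ⊥-elim (<-irrefl (sym eq) (x<L u<g))
  chord-weight-injective {1} {0} _ _ eq = ⊥-elim (<-irrefl (sym eq) L<M+L)
  chord-weight-injective {1} {1} _ _ _ = refl
  chord-weight-injective {1} {suc (suc u)} _ (s≤s (s≤s u<g)) eq = ⊥-elim (<-irrefl (sym eq) (<-trans (x<L u<g) L<M+L))
  chord-weight-injective {suc (suc u)} {0} (s≤s (s≤s u<g)) _ eq = ⊥-elim (<-irrefl eq (x<L u<g))
  chord-weight-injective {suc (suc u)} {1} (s≤s (s≤s u<g)) _ eq = ⊥-elim (<-irrefl eq (<-trans (x<L u<g) L<M+L))
  chord-weight-injective {suc (suc u)} {suc (suc u′)} _ _ eq =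
    cong (suc ∘ suc) (*-cancelˡ-≡ u u′ 3 (+-cancelˡ-≡ M (3 * u) (3 * u′) eq))

  two-unblocked-chords : ∀ (F : Faults) → length F ≤ g →
    ∃₂ λ s t → s < t × t < 2 + g × ¬ ChordBlocked F s × ¬ ChordBlocked F t
  two-unblocked-chords F |F|≤g = count+2≤⇒∃₂¬ (λ t → any? (λ e → hits? e t) F) (2 + g) (begin
    count (λ t → any? (λ e → hits? e t) F) (2 + g) + 2  ≤⟨ +-monoˡ-≤ 2 (count-any hits? (2 + g) 1 hits≤1 F) ⟩
    length F * 1 + 2                                     ≡⟨ cong (_+ 2) (*-identityʳ (length F)) ⟩
    length F + 2                                         ≤⟨ +-monoˡ-≤ 2 |F|≤g ⟩
    g + 2                                                ≡⟨ +-comm g 2 ⟩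
    2 + g                                                ∎)
    where
    open ≤-Reasoning
    hits≤1 : ∀ e → count (hits? e) (2 + g) ≤ 1
    hits≤1 e = count≤1 (hits? e) (2 + g) λ s< t< hs ht →
      chord-weight-injective s< t< (trans (sym (hits⇒weight s< hs)) (hits⇒weight t< ht))

  unblocked-chord : ∀ {F t} → t < 2 + g → ¬ ChordBlocked F t → Adj∖ F (p (chordLo t)) (p (chordHi t))
  unblocked-chord t< unblocked = chord-edge t< , Sum.[ unblocked ∘ Any.map inj₁ , unblocked ∘ Any.map inj₂ ]

  Touches : V × V → ℕ → Set
  Touches (u , v) c = lane u ≡ suc c ⊎ lane v ≡ suc c

  touches? : ∀ e c → Dec (Touches e c)
  touches? (u , v) c = lane u ≟ suc c ⊎-dec lane v ≟ suc c

  LaneBlocked : Faults → ℕ → Set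
  LaneBlocked F c = Any (λ e → Touches e c) F

  -- Lane suc c is spare for c < 2g + 1, and a fault touches at most two lanes.
  free-lane : ∀ (F : Faults) → length F ≤ g → ∃ λ c → c < 1 + 2 * g × ¬ LaneBlocked F c
  free-lane F |F|≤g = count<⇒∃¬ (λ c → any? (λ e → touches? e c) F) (1 + 2 * g) (s≤s (begin
    count (λ c → any? (λ e → touches? e c) F) (1 + 2 * g) ≤⟨ count-any touches? (1 + 2 * g) 2 touches≤2 F ⟩
    length F * 2                                         ≤⟨ *-monoˡ-≤ 2 |F|≤g ⟩
    g * 2                                                ≡⟨ *-comm g 2 ⟩
    2 * g                                                ∎))
    where
    open ≤-Reasoning
    lane≤1 : ∀ u → count (λ c → lane u ≟ suc c) (1 + 2 * g) ≤ 1
    lane≤1 u = count≤1 (λ c → lane u ≟ suc c) (1 + 2 * g) λ _ _ eq eq′ → suc-injective (trans (sym eq) eq′)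
    touches≤2 : ∀ e → count (touches? e) (1 + 2 * g) ≤ 2
    touches≤2 (u , v) = ≤-trans (count-⊎ (λ c → lane u ≟ suc c) (λ c → lane v ≟ suc c) (1 + 2 * g))
                                (+-mono-≤ (lane≤1 u) (lane≤1 v))

  free-lane-edge : ∀ {F c u v} → ¬ LaneBlocked F c → Touches (u , v) c → Graph.adj G u v ≡ true → Adj∖ F u v
  free-lane-edge free touches adj =
    adj , Sum.[ free ∘ Any.map (λ { refl → touches }) , free ∘ Any.map (λ { refl → Sum.swap touches }) ]

  -- Faults may cut lane 0 outside the subpath under attack; an untouched spare lane bypasses them
  -- without making the walk longer.
  free-lane-detour : ∀ {F c i j} → ¬ LaneBlocked F c → c < 1 + 2 * g → suc i < j → j ≤ L →
                     Walk (Adj∖ F) (p i) (p j) (j ∸ i)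
  free-lane-detour {F} {c} {i} {suc (suc j)} free c< (s≤s (s≤s i≤j)) j+2≤L =
    subst (Walk (Adj∖ F) (p i) (p (2 + j))) length-eq
          (enter ◅ (walk-between q run-steps (s≤s i≤j) ◅◅ (exit ◅ ε)))
    where
    q : ℕ → V
    q l = vertex l (suc c)
    c<W : suc c < W
    c<W = s≤s c<
    j+1≤L : suc j ≤ L
    j+1≤L = ≤-trans (n≤1+n _) j+2≤L
    enter : Adj∖ F (p i) (q (suc i))
    enter = free-lane-edge free (inj₂ (lane-vertex (suc i) c<W))
              (near⇒edge (≤-trans (≤-trans (n≤1+n i) (s≤s i≤j)) j+1≤L) (≤-trans (s≤s i≤j) j+1≤L) 0<W c<W
                         (inj₁ (inj₁ refl)))
    run-steps : Steps {R = Adj∖ F} q (suc i) (suc j)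
    run-steps {l} _ l<1+j = free-lane-edge free (inj₁ (lane-vertex l c<W))
              (near⇒edge (≤-trans (<⇒≤ l<1+j) j+1≤L) (≤-trans l<1+j j+1≤L) c<W c<W (inj₁ (inj₁ refl)))
    exit : Adj∖ F (q (suc j)) (p (2 + j))
    exit = free-lane-edge free (inj₁ (lane-vertex (suc j) c<W))
              (near⇒edge j+1≤L j+2≤L c<W 0<W (inj₁ (inj₁ refl)))
    length-eq : suc ((j ∸ i) + 1) ≡ 2 + j ∸ i
    length-eq = trans (cong suc (+-comm (j ∸ i) 1)) (sym (+-∸-assoc 2 i≤j))

  -- Splitting π

  replacement-run : ∀ {r k m} → ReplacementPath G r (run (p ∘ (k +_)) m) →
    ∃ λ F → length F ≤ r × Steps {R = Adj∖ F} p k (k + m) ×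
            (∀ {n} → Walk (Adj∖ F) (p (k + 0)) (p (k + m)) n → m ≤ n)
  replacement-run {k = k} {m} (F , _ , |F|≤r , _ , linked , shortest) =
    F , |F|≤r , linked-run⇒steps p k m linked ,
    λ w → s≤s⁻¹ (subst (_≤ _) (length-run _ m) (shortest≤walk shortest (head-run _ m) (last-run _ m) w))

  prefix-not-replacement : ∀ {k} → M ≤ k → k ≤ L → ¬ ReplacementPath G g (run p k)
  prefix-not-replacement {k@(suc k′)} M≤k k≤L rp with replacement-run {k = 0} rp
  ... | F , |F|≤g , steps , shortest = refute (two-unblocked-chords F |F|≤g)
    where
    no-shortcut : ∀ {n} → Walk (Adj∖ F) (p 0) (p k) n → ¬ n < k
    no-shortcut w n<k = <⇒≱ n<k (shortest w)

    along : ∀ {i j} → i ≤ j → j ≤ k → Walk (Adj∖ F) (p i) (p j) (j ∸ i)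
    along i≤j j≤k = walk-between {R = Adj∖ F} p (steps-within {R = Adj∖ F} steps z≤n j≤k) i≤j

    refute : (∃₂ λ s t → s < t × t < 2 + g × ¬ ChordBlocked F s × ¬ ChordBlocked F t) → ⊥
    refute (0 , 1 , _ , t< , free₀ , free₁) =
      no-shortcut (unblocked-chord z<s free₀ ◅ Adj∖-sym (unblocked-chord t< free₁) ◅ along M≤k ≤-refl)
                  (m<n⇒m+[o∸n]<o (s≤s (s≤s (s≤s z≤n))) M≤k)
    refute (_ , suc (suc u) , _ , t< , _ , free) with x u ≤? k
    ... | yes x≤k =
      no-shortcut (unblocked-chord t< free ◅ along x≤k ≤-refl)
                  (m<n⇒m+[o∸n]<o (s≤s (s≤s z≤n)) x≤k)
    ... | no x≰k with free-lane F |F|≤g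
    ...   | c , c< , free-c =
      no-shortcut (unblocked-chord t< free ◅ reverse Adj∖-sym (free-lane-detour free-c c< k<x (x≤L u<g))
                   ◅◅ steps z≤n ≤-refl ◅ ε)
                  (s≤s (subst (_≤ k′) (+-suc (x u ∸ k′) 1)
                                ([m∸n]+o≤n (<⇒≤ (<-trans (n<1+n k′) k<x)) (x+2≤k+k u<g M≤k))))
      where
      u<g : u < g
      u<g = s≤s⁻¹ (s≤s⁻¹ t<)
      k<x : k < x u
      k<x = ≰⇒> x≰k
    refute (suc _ , 1 , s≤s () , _)

  suffix-not-replacement : ∀ {k m} → k < M → k + m ≡ L → ¬ ReplacementPath G g (run (p ∘ (k +_)) m)
  suffix-not-replacement {k} {m} k<M k+m≡L rp with replacement-run rp
  ... | F , |F|≤g , steps , shortest = refute (two-unblocked-chords F |F|≤g)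
    where
    no-shortcut : ∀ {n} → Walk (Adj∖ F) (p k) (p L) n → ¬ n < m
    no-shortcut {n} w n<m = <⇒≱ n<m (shortest (subst₂ (λ a b → Walk (Adj∖ F) (p a) (p b) n)
                                               (sym (+-identityʳ k)) (sym k+m≡L) w))

    along : ∀ {i j} → k ≤ i → i ≤ j → j ≤ L → Walk (Adj∖ F) (p i) (p j) (j ∸ i)
    along {j = j} k≤i i≤j j≤L = walk-between {R = Adj∖ F} p
      (steps-within {R = Adj∖ F} steps k≤i (subst (j ≤_) (sym k+m≡L) j≤L)) i≤j

    shorter : ∀ {a c} → k ≤ a → a + c < L → (a ∸ k) + c < m
    shorter {a} {c} k≤a lt = [m∸n]+o<p k≤a (subst (a + c <_) (sym k+m≡L) lt)

    k≤x : ∀ u → k ≤ x u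
    k≤x u = ≤-trans (<⇒≤ k<M) (m≤m+n M _)

    via-chord₁ : ¬ ChordBlocked F 1 → ⊥
    via-chord₁ free = no-shortcut (along ≤-refl (<⇒≤ k<M) M≤L ◅◅ unblocked-chord (s≤s z<s) free ◅ ε)
                                  (shorter (<⇒≤ k<M) M+1<L)

    refute : (∃₂ λ s t → s < t × t < 2 + g × ¬ ChordBlocked F s × ¬ ChordBlocked F t) → ⊥
    refute (0 , 1 , _ , _ , _ , free) = via-chord₁ free
    refute (1 , _ , _ , _ , free , _) = via-chord₁ free
    refute (0 , suc (suc u) , _ , t< , free₀ , free) =
      no-shortcut (along ≤-refl (k≤x u) (x≤L (s≤s⁻¹ (s≤s⁻¹ t<)))
                   ◅◅ Adj∖-sym (unblocked-chord t< free) ◅ unblocked-chord z<s free₀ ◅ ε)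
                  (shorter (k≤x u) (<-≤-trans (+-monoʳ-< (x u) ≤-refl) (x+3≤L (s≤s⁻¹ (s≤s⁻¹ t<)))))
    refute (suc (suc u) , suc (suc u′) , s≤s (s≤s u<u′) , t< , free , free′) =
      no-shortcut (along ≤-refl (k≤x u) (x≤L u<g)
                   ◅◅ Adj∖-sym (unblocked-chord (<-trans (s≤s (s≤s u<u′)) t<) free)
                   ◅ unblocked-chord t< free′ ◅ along (k≤x u′) (x≤L u′<g) ≤-refl)
                  (shorter (k≤x u) (subst (_< L) (+-assoc (x u) 2 _) (m<n⇒m+[o∸n]<o x+2<x′ (x≤L u′<g))))
      where
      u′<g : u′ < g
      u′<g = s≤s⁻¹ (s≤s⁻¹ t<)
      u<g : u < g
      u<g = <-trans u<u′ u′<g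
      x+2<x′ : x u + 2 < x u′
      x+2<x′ = ≤-trans (≤-reflexive (sym (+-suc (x u) 2))) (x-gap u<u′)

  π-has-no-2-partition : ¬ Partition (ReplacementPath G g) 2 π
  π-has-no-2-partition (xs , m , ys , π≡ , left , right) with run-split p L xs m ys π≡
  ... | k , l , k+l≡L , left≡ , right≡ with M ≤? k
  ...   | yes M≤k = prefix-not-replacement M≤k (subst (k ≤_) k+l≡L (m≤m+n k l))
                                          (subst (ReplacementPath G g) left≡ left)
  ...   | no M≰k = suffix-not-replacement (≰⇒> M≰k) k+l≡L (subst (ReplacementPath G g) right≡ right)

proposition3p1 : ∀ (f : ℕ) → 2 ≤ f →
    Σ Graph λ G → Σ (List (Vertex G)) λ π →
      ReplacementPath G f π × ¬ Partition (ReplacementPath G (f ∸ 2)) 2 π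
proposition3p1 (suc zero) (s≤s ())
proposition3p1 (suc (suc g)) _ = G , π , π-replacement , π-has-no-2-partition
  where open Construction g
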